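{- For all positive integers $n$ and all integers $k\ge 0$, the number of 2-stack sortable $n$-permutations with exactly $k$ descents equals the number of 2-stack sortable $n$-permutations with exactly $k$ ascents.
   Context: An $n$-permutation is a permutation $p=(p_1,\ldots,p_n)$ of $\{1,\ldots,n\}$, written as a word. An index $i$ is a descent of $p$ if $p_i>p_{i+1}$ and an ascent if $p_i<p_{i+1}$. The stack-sorting operation $\Pi$ is defined recursively on words of distinct integers: $\Pi$ of the empty word is empty, and if $p=p_L\, m\, p_R$ where $m$ is the maximal entry, then $\Pi(p)=\Pi(p_L)\Pi(p_R)m$. A permutation $p$ is 2-stack sortable if $\Pi(\Pi(p))$ is the identity permutation. -}

module Defs where

open import Data.Nat using (ℕ; zero; suc; _<_; _>_; _≤_; _<?_; _⊔_)
open import Data.Nat.Properties using (_≟_)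
open import Data.List using (List; []; _∷_; _++_; length; filter; concatMap; map; upTo; foldr)
open import Data.Product using (_×_; _,_)
open import Relation.Nullary using (Dec; yes; no)
open import Relation.Binary.PropositionalEquality using (_≡_)
open import Data.List.Properties using (≡-dec)

-- Words are lists of natural numbers; an n-permutation is a word that is a
-- rearrangement of 1,…,n.

insertEverywhere : ℕ → List ℕ → List (List ℕ)
insertEverywhere x [] = (x ∷ []) ∷ []
insertEverywhere x (y ∷ ys) = (x ∷ y ∷ ys) ∷ map (y ∷_) (insertEverywhere x ys)

perms : ℕ → List (List ℕ)
perms zero = [] ∷ []
perms (suc n) = concatMap (insertEverywhere (suc n)) (perms n)

-- maximum entry (0 for the empty word)
maxW : List ℕ → ℕ
maxW = foldr _⊔_ 0

splitAt≡ : ℕ → List ℕ → List ℕ × List ℕ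
splitAt≡ m [] = [] , []
splitAt≡ m (x ∷ xs) with x ≟ m
... | yes _ = [] , xs
... | no _ with splitAt≡ m xs
...   | (l , r) = (x ∷ l) , r

-- stack-sorting map Π, with fuel (fuel = length suffices)
Πf : ℕ → List ℕ → List ℕ
Πf zero p = p
Πf (suc f) [] = []
Πf (suc f) (x ∷ xs) with splitAt≡ (maxW (x ∷ xs)) (x ∷ xs)
... | (l , r) = Πf f l ++ Πf f r ++ (maxW (x ∷ xs) ∷ [])

Π : List ℕ → List ℕ
Π p = Πf (length p) p

twoStackSortable : List ℕ → Set
twoStackSortable p = Π (Π p) ≡ map suc (upTo (length p))

desFrom : ℕ → List ℕ → ℕ
desFrom x [] = 0
desFrom x (y ∷ ys) with y <? x
... | yes _ = suc (desFrom y ys)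
... | no _ = desFrom y ys

des : List ℕ → ℕ
des [] = 0
des (x ∷ xs) = desFrom x xs

ascFrom : ℕ → List ℕ → ℕ
ascFrom x [] = 0
ascFrom x (y ∷ ys) with x <? y
... | yes _ = suc (ascFrom y ys)
... | no _ = ascFrom y ys

asc : List ℕ → ℕ
asc [] = 0
asc (x ∷ xs) = ascFrom x xs

twoStackSortable? : (p : List ℕ) → Dec (twoStackSortable p)
twoStackSortable? p = ≡-dec _≟_ (Π (Π p)) (map suc (upTo (length p)))

{-# OPTIONS --safe #-}
module Submission where

-- Write a word as p = L m R around its maximum m. The involution φ is
--   φ(L m R) = φ(L) m φ(R),  except  φ(m R) = φ(R) m  and  φ(L m) = m φ(L)  for L, R ≠ [],
-- i.e. in the decreasing binary tree of p every only child changes side. Since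
-- Π(L m R) = Π(L) Π(R) m and one side is empty whenever the sides are exchanged, Π ∘ φ = Π, so
-- φ preserves 2-stack sortability. The maximum ends an ascent iff L ≠ [] and starts a descent
-- iff R ≠ [], which gives des ∘ φ = asc.

open import Defs
open import Algebra.Bundles using (Monoid)
open import Data.Bool using (true; false)
open import Data.Empty using (⊥-elim)
open import Data.List using (List; []; _∷_; _++_; length; map; filter; concatMap; upTo; applyDownFrom)
open import Data.List.Membership.Propositional using (_∈_; _∉_)
open import Data.List.Membership.Propositional.Properties
  using (∈-map⁺; ∈-map⁻; ∈-∃++; ∈-concat⁺′; ∈-concat⁻′)
open import Data.List.Membership.Propositional.Properties.WithK using (unique∧set⇒bag)
open import Data.List.Properties
  using (length-++; ++-conicalʳ; ++-assoc; ++-monoid; foldr-preservesᵇ; ∷-injectiveˡ; ∷-injectiveʳ;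
         filter-++; filter-all; filter-reject; map-∘; map-id-local)
open import Data.List.Relation.Binary.BagAndSetEquality using (∼bag⇒↭)
open import Data.List.Relation.Binary.Disjoint.Propositional using (Disjoint)
import Data.List.Relation.Binary.Disjoint.Propositional.Properties as Disjoint
open import Data.List.Relation.Binary.Permutation.Propositional
  using (_↭_; ↭-refl; ↭-sym; ↭-trans; ↭-reflexive; prep; ↭⇒↭ₛ)
open import Data.List.Relation.Binary.Permutation.Propositional.Properties
  using (++⁺; ∷↭∷ʳ; ↭-length; All-resp-↭; ∈-resp-↭; shift; drop-mid; ↭-empty-inv; filter-↭)
open import Data.List.Relation.Unary.All as All using (All; []; _∷_)
import Data.List.Relation.Unary.All.Properties as All
open import Data.List.Relation.Unary.AllPairs using ([]; _∷_)
open import Data.List.Relation.Unary.Any using (here; there)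
open import Data.List.Relation.Unary.Unique.Propositional using (Unique)
import Data.List.Relation.Unary.Unique.Propositional.Properties as Unique
open import Data.Nat using (ℕ; zero; suc; _≤_; _<_; _⊔_; _⊓_; _+_; z≤n; _<?_; _≟_)
open import Data.Nat.Properties
  using (≤-refl; ≤-trans; <⇒≤; <⇒≢; <-irrefl; <-asym; ≤∧≢⇒<; suc-injective; ≤-pred;
         m+n≤o⇒m≤o; m+n≤o⇒n≤o; ⊔-lub; ⊔-sel; ⊔-identityʳ; m≤m⊔n; m≤n⊔m; m≤n⇒m⊔n≡n; m≥n⇒m⊔n≡m; ≟-diag;
         +-comm; +-assoc; +-suc; +-identityʳ; +-0-monoid)
open import Data.Product using (_×_; _,_; proj₁; proj₂; ∃₂)
import Data.Product as Product
open import Data.Product.Function.NonDependent.Propositional using (_×-⇔_)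
open import Data.Sum using (inj₁; inj₂)
open import Function using (_∘_; case_of_)
open import Function.Bundles using (_⇔_; mk⇔)
open import Relation.Nullary using (yes; no; ¬?; does)
open import Relation.Nullary.Decidable using (does-⇔; _×-dec_)
open import Relation.Unary using (Decidable)
import Relation.Binary.PropositionalEquality as ≡
open ≡ using (_≡_; _≢_; refl; sym; trans; cong; cong₂; subst; subst₂; ≢-sym; module ≡-Reasoning)
open import Data.List.Relation.Binary.Permutation.Setoid.Properties (≡.setoid ℕ) using (Unique-resp-↭)

maxW-ub : ∀ p → All (_≤ maxW p) p
maxW-ub [] = []
maxW-ub (x ∷ xs) = m≤m⊔n x (maxW xs) ∷ All.map (λ y≤ → ≤-trans y≤ (m≤n⊔m x (maxW xs))) (maxW-ub xs)

maxW-lub : ∀ {m p} → All (_≤ m) p → maxW p ≤ m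
maxW-lub = foldr-preservesᵇ ⊔-lub z≤n

maxW-∈ : ∀ x xs → maxW (x ∷ xs) ∈ x ∷ xs
maxW-∈ x [] rewrite ⊔-identityʳ x = here refl
maxW-∈ x (y ∷ ys) with ⊔-sel x (maxW (y ∷ ys))
... | inj₁ x⊔≡x rewrite x⊔≡x = here refl
... | inj₂ x⊔≡max rewrite x⊔≡max = there (maxW-∈ y ys)

maxW-middle : ∀ {L m R} → All (_< m) L → All (_< m) R → maxW (L ++ m ∷ R) ≡ m
maxW-middle [] R<m = m≥n⇒m⊔n≡m (maxW-lub (All.map <⇒≤ R<m))
maxW-middle {l ∷ _} (l<m ∷ L<m) R<m = trans (cong (l ⊔_) (maxW-middle L<m R<m)) (m≤n⇒m⊔n≡n (<⇒≤ l<m))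

splitAt≡-rejoin : ∀ {m p} → m ∈ p → p ≡ proj₁ (splitAt≡ m p) ++ m ∷ proj₂ (splitAt≡ m p)
splitAt≡-rejoin {m} {x ∷ xs} m∈p with x ≟ m
... | yes refl = refl
splitAt≡-rejoin (here refl) | no x≢m = ⊥-elim (x≢m refl)
splitAt≡-rejoin {p = x ∷ _} (there m∈xs) | no _ = cong (x ∷_) (splitAt≡-rejoin m∈xs)

splitAt≡-middle : ∀ {L m R} → All (_< m) L → splitAt≡ m (L ++ m ∷ R) ≡ (L , R)
splitAt≡-middle {[]} {m} [] rewrite ≟-diag (refl {x = m}) = refl
splitAt≡-middle {l ∷ _} {m} (l<m ∷ L<m) with l ≟ m
... | yes refl = ⊥-elim (<-irrefl refl l<m)
... | no _ = cong (Product.map₁ (l ∷_)) (splitAt≡-middle L<m)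

Unique-middle⁻ : ∀ {A : Set} L {x : A} {R} → Unique (L ++ x ∷ R) →
                 All (_≢ x) L × All (_≢ x) R × Unique L × Unique R
Unique-middle⁻ [] (x≢R ∷ uR) = [] , All.map ≢-sym x≢R , [] , uR
Unique-middle⁻ (l ∷ L) (l≢ ∷ u) with Unique-middle⁻ L u
... | L≢x , R≢x , uL , uR = All.head (All.++⁻ʳ L l≢) ∷ L≢x , R≢x , All.++⁻ˡ L l≢ ∷ uL , uR

length-middle : ∀ {A : Set} L {x : A} {R} → length (L ++ x ∷ R) ≡ suc (length L + length R)
length-middle L {R = R} = trans (length-++ L) (+-suc (length L) (length R))

maxInduction : (P : ℕ → List ℕ → Set) → (∀ f → P f []) →
               (∀ {f L m R} → All (_< m) L → All (_< m) R → P f L → P f R → P (suc f) (L ++ m ∷ R)) →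
               ∀ {f p} → length p ≤ f → Unique p → P f p
maxInduction P base step {f} {[]} _ _ = base f
maxInduction P base step {suc f} {p@(x ∷ xs)} |p|≤1+f p! =
  split (Unique-middle⁻ L (subst Unique p≡LmR p!)) (All.++⁻ L (subst (All (_≤ m)) p≡LmR (maxW-ub p)))
  where
  m = maxW p
  L = proj₁ (splitAt≡ m p)
  R = proj₂ (splitAt≡ m p)
  p≡LmR : p ≡ L ++ m ∷ R
  p≡LmR = splitAt≡-rejoin (maxW-∈ x xs)
  |L|+|R|≤f : length L + length R ≤ f
  |L|+|R|≤f = ≤-pred (subst (_≤ suc f) (trans (cong length p≡LmR) (length-middle L)) |p|≤1+f)
  strict : ∀ {ys} → All (_≤ m) ys → All (_≢ m) ys → All (_< m) ys
  strict ys≤m ys≢m = All.zipWith (Product.uncurry ≤∧≢⇒<) (ys≤m , ys≢m)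
  split : All (_≢ m) L × All (_≢ m) R × Unique L × Unique R → All (_≤ m) L × All (_≤ m) (m ∷ R) →
          P (suc f) p
  split (L≢m , R≢m , L! , R!) (L≤m , _ ∷ R≤m) =
    subst (P (suc f)) (sym p≡LmR)
      (step (strict L≤m L≢m) (strict R≤m R≢m)
        (maxInduction P base step (m+n≤o⇒m≤o (length L) |L|+|R|≤f) L!)
        (maxInduction P base step (m+n≤o⇒n≤o (length L) |L|+|R|≤f) R!))

-- Recursion along the decreasing binary tree

maxRec : (List ℕ → ℕ → List ℕ → List ℕ) → ℕ → List ℕ → List ℕ
maxRec c zero p = p
maxRec c (suc f) [] = []
maxRec c (suc f) p@(_ ∷ _) =
  let (L , R) = splitAt≡ (maxW p) p in c (maxRec c f L) (maxW p) (maxRec c f R)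

module _ (c : List ℕ → ℕ → List ℕ → List ℕ) where

  maxRec-[] : ∀ f → maxRec c f [] ≡ []
  maxRec-[] zero = refl
  maxRec-[] (suc f) = refl

  maxRec-↭ : (∀ A m B → c A m B ↭ A ++ m ∷ B) → ∀ f p → maxRec c f p ↭ p
  maxRec-↭ c-↭ zero p = ↭-refl
  maxRec-↭ c-↭ (suc f) [] = ↭-refl
  maxRec-↭ c-↭ (suc f) (x ∷ xs) =
    ↭-trans (c-↭ _ _ _)
      (↭-trans (++⁺ (maxRec-↭ c-↭ f _) (prep _ (maxRec-↭ c-↭ f _)))
        (↭-reflexive (sym (splitAt≡-rejoin (maxW-∈ x xs)))))

  maxRec-step : ∀ {f p L m R} → p ≢ [] → maxW p ≡ m → splitAt≡ m p ≡ (L , R) →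
                maxRec c (suc f) p ≡ c (maxRec c f L) m (maxRec c f R)
  maxRec-step {p = []} p≢[] = ⊥-elim (p≢[] refl)
  maxRec-step {p = _ ∷ _} _ refl split≡ rewrite split≡ = refl

  maxRec-unfold : ∀ {f L m R} → All (_< m) L → All (_< m) R →
                  maxRec c (suc f) (L ++ m ∷ R) ≡ c (maxRec c f L) m (maxRec c f R)
  maxRec-unfold {L = L} {m} {R} L<m R<m =
    maxRec-step (λ p≡[] → case ++-conicalʳ L (m ∷ R) p≡[] of λ ())
                (maxW-middle L<m R<m) (splitAt≡-middle L<m)

Πjoin : List ℕ → ℕ → List ℕ → List ℕ
Πjoin A m B = A ++ B ++ m ∷ []

Πf-maxRec : ∀ f p → Πf f p ≡ maxRec Πjoin f p
Πf-maxRec zero p = refl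
Πf-maxRec (suc f) [] = refl
Πf-maxRec (suc f) (x ∷ xs) with splitAt≡ (maxW (x ∷ xs)) (x ∷ xs)
... | l , r = cong₂ (λ A B → A ++ B ++ maxW (x ∷ xs) ∷ []) (Πf-maxRec f l) (Πf-maxRec f r)

Πf-[] : ∀ f → Πf f [] ≡ []
Πf-[] f = trans (Πf-maxRec f []) (maxRec-[] Πjoin f)

Πf-unfold : ∀ {f L m R} → All (_< m) L → All (_< m) R →
            Πf (suc f) (L ++ m ∷ R) ≡ (Πf f L ++ Πf f R) ++ m ∷ []
Πf-unfold {f} {L} {m} {R} L<m R<m = begin
  Πf (suc f) (L ++ m ∷ R)                        ≡⟨ Πf-maxRec (suc f) (L ++ m ∷ R) ⟩
  maxRec Πjoin (suc f) (L ++ m ∷ R)              ≡⟨ maxRec-unfold Πjoin L<m R<m ⟩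
  maxRec Πjoin f L ++ maxRec Πjoin f R ++ m ∷ []
    ≡⟨ cong₂ (λ A B → A ++ B ++ m ∷ []) (Πf-maxRec f L) (Πf-maxRec f R) ⟨
  Πf f L ++ Πf f R ++ m ∷ []                     ≡⟨ ++-assoc (Πf f L) (Πf f R) (m ∷ []) ⟨
  (Πf f L ++ Πf f R) ++ m ∷ []                   ∎
  where open ≡-Reasoning

-- The involution φ

module _ {A : Set} where

  flank : List A × List A → List A × List A
  flank ([] , R) = R , []
  flank (L@(_ ∷ _) , []) = [] , L
  flank (L@(_ ∷ _) , R@(_ ∷ _)) = L , R

  flank-involutive : ∀ s → flank (flank s) ≡ s
  flank-involutive ([] , []) = refl
  flank-involutive ([] , _ ∷ _) = refl
  flank-involutive (_ ∷ _ , []) = refl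
  flank-involutive (_ ∷ _ , _ ∷ _) = refl

  flank-map : ∀ {g : List A → List A} → (∀ xs → length (g xs) ≡ length xs) →
              ∀ s → flank (Product.map g g s) ≡ Product.map g g (flank s)
  flank-map {g} |g| ([] , R) with g [] | |g| []
  ... | [] | _ = refl
  flank-map {g} |g| (L@(_ ∷ _) , []) with g L | |g| L | g [] | |g| []
  ... | _ ∷ _ | _ | [] | _ = refl
  flank-map {g} |g| (L@(_ ∷ _) , R@(_ ∷ _)) with g L | |g| L | g R | |g| R
  ... | _ ∷ _ | _ | _ ∷ _ | _ = refl

  flank-right-nonempty : ∀ s → 1 ⊓ length (proj₂ (flank s)) ≡ 1 ⊓ length (proj₁ s)
  flank-right-nonempty ([] , _) = refl
  flank-right-nonempty (_ ∷ _ , []) = refl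
  flank-right-nonempty (_ ∷ _ , _ ∷ _) = refl

  flank-All : ∀ {P : A → Set} {L R} → All P L → All P R →
              All P (proj₁ (flank (L , R))) × All P (proj₂ (flank (L , R)))
  flank-All {L = []} PL PR = PR , []
  flank-All {L = _ ∷ _} {[]} PL PR = [] , PL
  flank-All {L = _ ∷ _} {_ ∷ _} PL PR = PL , PR

module _ {c ℓ} (M : Monoid c ℓ) {A : Set} where
  open Monoid M using (Carrier; _≈_; _∙_; ε; ∙-congˡ; ∙-congʳ; identityˡ; identityʳ)
  open import Relation.Binary.Reasoning.Setoid (Monoid.setoid M)

  flank-∙ : (h : List A → Carrier) → h [] ≈ ε →
            ∀ s → h (proj₁ (flank s)) ∙ h (proj₂ (flank s)) ≈ h (proj₁ s) ∙ h (proj₂ s)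
  flank-∙ h h[]≈ε ([] , R) = begin
    h R ∙ h []  ≈⟨ ∙-congˡ h[]≈ε ⟩
    h R ∙ ε     ≈⟨ identityʳ (h R) ⟩
    h R         ≈⟨ identityˡ (h R) ⟨
    ε ∙ h R     ≈⟨ ∙-congʳ h[]≈ε ⟨
    h [] ∙ h R  ∎
  flank-∙ h h[]≈ε (L@(_ ∷ _) , []) = begin
    h [] ∙ h L  ≈⟨ ∙-congʳ h[]≈ε ⟩
    ε ∙ h L     ≈⟨ identityˡ (h L) ⟩
    h L         ≈⟨ identityʳ (h L) ⟨
    h L ∙ ε     ≈⟨ ∙-congˡ h[]≈ε ⟨
    h L ∙ h []  ∎
  flank-∙ h h[]≈ε (_ ∷ _ , _ ∷ _) = Monoid.refl M

joinAt : ℕ → List ℕ × List ℕ → List ℕ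
joinAt m (A , B) = A ++ m ∷ B

joinAt-flank-↭ : ∀ A m B → joinAt m (flank (A , B)) ↭ A ++ m ∷ B
joinAt-flank-↭ [] m B = ↭-sym (∷↭∷ʳ m B)
joinAt-flank-↭ A@(_ ∷ _) m [] = ∷↭∷ʳ m A
joinAt-flank-↭ (_ ∷ _) m (_ ∷ _) = ↭-refl

flankJoin : List ℕ → ℕ → List ℕ → List ℕ
flankJoin A m B = joinAt m (flank (A , B))

φf : ℕ → List ℕ → List ℕ
φf = maxRec flankJoin

φf-[] : ∀ f → φf f [] ≡ []
φf-[] = maxRec-[] flankJoin

φf-↭ : ∀ f p → φf f p ↭ p
φf-↭ = maxRec-↭ flankJoin joinAt-flank-↭

φf-length : ∀ f p → length (φf f p) ≡ length p
φf-length f p = ↭-length (φf-↭ f p)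

module _ {f m : ℕ} {L R : List ℕ} (L<m : All (_< m) L) (R<m : All (_< m) R) where

  φf-unfold : φf (suc f) (L ++ m ∷ R) ≡ joinAt m (flank (φf f L , φf f R))
  φf-unfold = maxRec-unfold flankJoin L<m R<m

  flank-φf-< : All (_< m) (proj₁ (flank (φf f L , φf f R))) × All (_< m) (proj₂ (flank (φf f L , φf f R)))
  flank-φf-< = flank-All (All-resp-↭ (↭-sym (φf-↭ f L)) L<m) (All-resp-↭ (↭-sym (φf-↭ f R)) R<m)

φf-involutive : ∀ {f p} → length p ≤ f → Unique p → φf f (φf f p) ≡ p
φf-involutive = maxInduction (λ f p → φf f (φf f p) ≡ p) base step
  where
  base : ∀ f → φf f (φf f []) ≡ []
  base f = trans (cong (φf f) (φf-[] f)) (φf-[] f)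
  step : ∀ {f L m R} → All (_< m) L → All (_< m) R → φf f (φf f L) ≡ L → φf f (φf f R) ≡ R →
         φf (suc f) (φf (suc f) (L ++ m ∷ R)) ≡ L ++ m ∷ R
  step {f} {L} {m} {R} L<m R<m φφL≡L φφR≡R = begin
    φf (suc f) (φf (suc f) (L ++ m ∷ R))           ≡⟨ cong (φf (suc f)) (φf-unfold {f} L<m R<m) ⟩
    φf (suc f) (joinAt m s)                        ≡⟨ φf-unfold (proj₁ s<m) (proj₂ s<m) ⟩
    joinAt m (flank (Product.map (φf f) (φf f) s)) ≡⟨ cong (joinAt m) (flank-map {g = φf f} (φf-length f) s) ⟩
    joinAt m (Product.map (φf f) (φf f) (flank s))
      ≡⟨ cong (joinAt m ∘ Product.map (φf f) (φf f)) (flank-involutive _) ⟩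
    joinAt m (φf f (φf f L) , φf f (φf f R))       ≡⟨ cong₂ (λ A B → joinAt m (A , B)) φφL≡L φφR≡R ⟩
    L ++ m ∷ R                                     ∎
    where
    open ≡-Reasoning
    s = flank (φf f L , φf f R)
    s<m = flank-φf-< {f} L<m R<m

Πf-φf : ∀ {f p} → length p ≤ f → Unique p → Πf f (φf f p) ≡ Πf f p
Πf-φf = maxInduction (λ f p → Πf f (φf f p) ≡ Πf f p) base step
  where
  base : ∀ f → Πf f (φf f []) ≡ Πf f []
  base f = cong (Πf f) (φf-[] f)
  step : ∀ {f L m R} → All (_< m) L → All (_< m) R →
         Πf f (φf f L) ≡ Πf f L → Πf f (φf f R) ≡ Πf f R →
         Πf (suc f) (φf (suc f) (L ++ m ∷ R)) ≡ Πf (suc f) (L ++ m ∷ R)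
  step {f} {L} {m} {R} L<m R<m ΠφL≡ΠL ΠφR≡ΠR = begin
    Πf (suc f) (φf (suc f) (L ++ m ∷ R))         ≡⟨ cong (Πf (suc f)) (φf-unfold {f} L<m R<m) ⟩
    Πf (suc f) (joinAt m s)                      ≡⟨ Πf-unfold (proj₁ s<m) (proj₂ s<m) ⟩
    (Πf f (proj₁ s) ++ Πf f (proj₂ s)) ++ m ∷ [] ≡⟨ cong (_++ m ∷ []) (flank-∙ (++-monoid ℕ) (Πf f) (Πf-[] f) _) ⟩
    (Πf f (φf f L) ++ Πf f (φf f R)) ++ m ∷ []   ≡⟨ cong₂ (λ A B → (A ++ B) ++ m ∷ []) ΠφL≡ΠL ΠφR≡ΠR ⟩
    (Πf f L ++ Πf f R) ++ m ∷ []                 ≡⟨ Πf-unfold {f} L<m R<m ⟨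
    Πf (suc f) (L ++ m ∷ R)                      ∎
    where
    open ≡-Reasoning
    s = flank (φf f L , φf f R)
    s<m = flank-φf-< {f} L<m R<m

-- Descents and ascents around the maximum

desFrom-++-max : ∀ {x xs m R} → All (_< m) (x ∷ xs) →
                 desFrom x (xs ++ m ∷ R) ≡ desFrom x xs + desFrom m R
desFrom-++-max {x} {[]} {m} (x<m ∷ []) with m <? x
... | yes m<x = ⊥-elim (<-asym m<x x<m)
... | no _ = refl
desFrom-++-max {x} {y ∷ ys} (_ ∷ ys<m) with y <? x
... | yes _ = cong suc (desFrom-++-max ys<m)
... | no _ = desFrom-++-max ys<m

desFrom-max : ∀ {m R} → All (_< m) R → desFrom m R ≡ des R + 1 ⊓ length R
desFrom-max [] = refl
desFrom-max {m} {r ∷ rs} (r<m ∷ _) with r <? m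
... | yes _ = +-comm 1 (desFrom r rs)
... | no r≮m = ⊥-elim (r≮m r<m)

ascFrom-++-max : ∀ {x xs m R} → All (_< m) (x ∷ xs) →
                 ascFrom x (xs ++ m ∷ R) ≡ ascFrom x xs + suc (ascFrom m R)
ascFrom-++-max {x} {[]} {m} (x<m ∷ []) with x <? m
... | yes _ = refl
... | no x≮m = ⊥-elim (x≮m x<m)
ascFrom-++-max {x} {y ∷ ys} (_ ∷ ys<m) with x <? y
... | yes _ = cong suc (ascFrom-++-max ys<m)
... | no _ = ascFrom-++-max ys<m

ascFrom-max : ∀ {m R} → All (_< m) R → ascFrom m R ≡ asc R
ascFrom-max [] = refl
ascFrom-max {m} {r ∷ _} (r<m ∷ _) with m <? r
... | yes m<r = ⊥-elim (<-asym m<r r<m)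
... | no _ = refl

des-middle-max : ∀ {L m R} → All (_< m) L → All (_< m) R → des (L ++ m ∷ R) ≡ des L + des R + 1 ⊓ length R
des-middle-max [] R<m = desFrom-max R<m
des-middle-max {x ∷ xs} {m} {R} L<m R<m = begin
  desFrom x (xs ++ m ∷ R)                  ≡⟨ desFrom-++-max L<m ⟩
  desFrom x xs + desFrom m R               ≡⟨ cong (desFrom x xs +_) (desFrom-max R<m) ⟩
  desFrom x xs + (des R + 1 ⊓ length R)    ≡⟨ +-assoc (desFrom x xs) (des R) _ ⟨
  desFrom x xs + des R + 1 ⊓ length R      ∎
  where open ≡-Reasoning

asc-middle-max : ∀ {L m R} → All (_< m) L → All (_< m) R → asc (L ++ m ∷ R) ≡ asc L + asc R + 1 ⊓ length L
asc-middle-max {[]} [] R<m = trans (ascFrom-max R<m) (sym (+-identityʳ _))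
asc-middle-max {x ∷ xs} {m} {R} L<m R<m = begin
  ascFrom x (xs ++ m ∷ R)                  ≡⟨ ascFrom-++-max L<m ⟩
  ascFrom x xs + suc (ascFrom m R)         ≡⟨ cong (λ a → ascFrom x xs + suc a) (ascFrom-max R<m) ⟩
  ascFrom x xs + suc (asc R)               ≡⟨ +-suc (ascFrom x xs) (asc R) ⟩
  suc (ascFrom x xs + asc R)               ≡⟨ +-comm (ascFrom x xs + asc R) 1 ⟨
  ascFrom x xs + asc R + 1                 ∎
  where open ≡-Reasoning

des-φf : ∀ {f p} → length p ≤ f → Unique p → des (φf f p) ≡ asc p
des-φf = maxInduction (λ f p → des (φf f p) ≡ asc p) base step
  where
  base : ∀ f → des (φf f []) ≡ 0
  base f = cong des (φf-[] f)
  step : ∀ {f L m R} → All (_< m) L → All (_< m) R →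
         des (φf f L) ≡ asc L → des (φf f R) ≡ asc R →
         des (φf (suc f) (L ++ m ∷ R)) ≡ asc (L ++ m ∷ R)
  step {f} {L} {m} {R} L<m R<m desφL≡ascL desφR≡ascR = begin
    des (φf (suc f) (L ++ m ∷ R))                        ≡⟨ cong des (φf-unfold {f} L<m R<m) ⟩
    des (joinAt m s)                                     ≡⟨ des-middle-max (proj₁ s<m) (proj₂ s<m) ⟩
    des (proj₁ s) + des (proj₂ s) + 1 ⊓ length (proj₂ s)
      ≡⟨ cong₂ _+_ (flank-∙ +-0-monoid des refl φLR) (flank-right-nonempty φLR) ⟩
    des (φf f L) + des (φf f R) + 1 ⊓ length (φf f L)
      ≡⟨ cong₂ _+_ (cong₂ _+_ desφL≡ascL desφR≡ascR) (cong (1 ⊓_) (φf-length f L)) ⟩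
    asc L + asc R + 1 ⊓ length L                         ≡⟨ asc-middle-max L<m R<m ⟨
    asc (L ++ m ∷ R)                                     ∎
    where
    open ≡-Reasoning
    φLR = (φf f L , φf f R)
    s = flank φLR
    s<m = flank-φf-< {f} L<m R<m

φ : List ℕ → List ℕ
φ p = φf (length p) p

φ-↭ : ∀ p → φ p ↭ p
φ-↭ p = φf-↭ (length p) p

φ-length : ∀ p → length (φ p) ≡ length p
φ-length p = φf-length (length p) p

φ-involutive : ∀ {p} → Unique p → φ (φ p) ≡ p
φ-involutive {p} p! = trans (cong (λ f → φf f (φ p)) (φ-length p)) (φf-involutive ≤-refl p!)

Π-φ : ∀ {p} → Unique p → Π (φ p) ≡ Π p
Π-φ {p} p! = trans (cong (λ f → Πf f (φ p)) (φ-length p)) (Πf-φf ≤-refl p!)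

des-φ : ∀ {p} → Unique p → des (φ p) ≡ asc p
des-φ = des-φf ≤-refl

twoStackSortable-φ : ∀ {p} → Unique p → twoStackSortable (φ p) ⇔ twoStackSortable p
twoStackSortable-φ {p} p! =
  mk⇔ (subst₂ Sorts (Π-φ p!) (φ-length p)) (subst₂ Sorts (sym (Π-φ p!)) (sym (φ-length p)))
  where
  Sorts : List ℕ → ℕ → Set
  Sorts q n = Π q ≡ map suc (upTo n)

insertEverywhere-∈⁻ : ∀ {x q r} → r ∈ insertEverywhere x q →
                      ∃₂ λ a b → q ≡ a ++ b × r ≡ a ++ x ∷ b
insertEverywhere-∈⁻ {q = []} (here refl) = [] , [] , refl , refl
insertEverywhere-∈⁻ {q = y ∷ ys} (here refl) = [] , y ∷ ys , refl , refl
insertEverywhere-∈⁻ {q = y ∷ ys} (there r∈) with ∈-map⁻ (y ∷_) r∈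
... | r′ , r′∈ , refl with insertEverywhere-∈⁻ r′∈
...   | a , b , refl , refl = y ∷ a , b , refl , refl

insertEverywhere-∈⁺ : ∀ {x} a b → a ++ x ∷ b ∈ insertEverywhere x (a ++ b)
insertEverywhere-∈⁺ [] [] = here refl
insertEverywhere-∈⁺ [] (_ ∷ _) = here refl
insertEverywhere-∈⁺ (y ∷ a) b = there (∈-map⁺ (y ∷_) (insertEverywhere-∈⁺ a b))

insertEverywhere-unique : ∀ {x q} → x ∉ q → Unique (insertEverywhere x q)
insertEverywhere-unique {q = []} _ = [] ∷ []
insertEverywhere-unique {q = _ ∷ _} x∉ =
  All.map⁺ (All.tabulate (λ _ eq → x∉ (here (∷-injectiveˡ eq))))
  ∷ Unique.map⁺ ∷-injectiveʳ (insertEverywhere-unique (x∉ ∘ there))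

insertEverywhere-erase : ∀ {x q r} → x ∉ q → r ∈ insertEverywhere x q →
                         filter (λ y → ¬? (x ≟ y)) r ≡ q
insertEverywhere-erase {x} x∉q r∈ with insertEverywhere-∈⁻ r∈
... | a , b , refl , refl = begin
  filter x≢? (a ++ x ∷ b)             ≡⟨ filter-++ x≢? a (x ∷ b) ⟩
  filter x≢? a ++ filter x≢? (x ∷ b)
    ≡⟨ cong₂ _++_ (filter-all x≢? x≢a) (filter-reject x≢? (λ x≢x → x≢x refl)) ⟩
  a ++ filter x≢? b                   ≡⟨ cong (a ++_) (filter-all x≢? x≢b) ⟩
  a ++ b                              ∎
  where
  open ≡-Reasoning
  x≢? = λ y → ¬? (x ≟ y)
  x≢a = proj₁ (All.++⁻ a (All.¬Any⇒All¬ (a ++ b) x∉q))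
  x≢b = proj₂ (All.++⁻ a (All.¬Any⇒All¬ (a ++ b) x∉q))

insertEverywhere-disjoint : ∀ {x q q′} → x ∉ q → x ∉ q′ → q ≢ q′ →
                            Disjoint (insertEverywhere x q) (insertEverywhere x q′)
insertEverywhere-disjoint x∉q x∉q′ q≢q′ (r∈ , r∈′) =
  q≢q′ (trans (sym (insertEverywhere-erase x∉q r∈)) (insertEverywhere-erase x∉q′ r∈′))

concatMap-insertEverywhere-unique : ∀ {x qs} → Unique qs → All (x ∉_) qs →
                                    Unique (concatMap (insertEverywhere x) qs)
concatMap-insertEverywhere-unique [] [] = []
concatMap-insertEverywhere-unique {x} {q ∷ _} (q≢qs ∷ qs!) (x∉q ∷ x∉qs) =
  Unique.++⁺ (insertEverywhere-unique x∉q) (concatMap-insertEverywhere-unique qs! x∉qs)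
    (Disjoint.concat⁺ʳ (All.map⁺ (All.zipWith disjoint (q≢qs , x∉qs))))
  where
  disjoint : ∀ {q′} → q ≢ q′ × x ∉ q′ → Disjoint (insertEverywhere x q) (insertEverywhere x q′)
  disjoint (q≢q′ , x∉q′) = insertEverywhere-disjoint x∉q x∉q′ q≢q′

applyDownFrom-suc-unique : ∀ n → Unique (applyDownFrom suc n)
applyDownFrom-suc-unique n = Unique.applyDownFrom⁺₁ suc n (λ j<i _ → <⇒≢ j<i ∘ sym ∘ suc-injective)

∈-perms⁻ : ∀ n {p} → p ∈ perms n → p ↭ applyDownFrom suc n
∈-perms⁻ zero (here refl) = ↭-refl
∈-perms⁻ (suc n) p∈ with ∈-concat⁻′ (map (insertEverywhere (suc n)) (perms n)) p∈
... | _ , p∈ins , ins∈ with ∈-map⁻ (insertEverywhere (suc n)) ins∈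
...   | q , q∈ , refl with insertEverywhere-∈⁻ p∈ins
...     | a , b , refl , refl = ↭-trans (shift (suc n) a b) (prep (suc n) (∈-perms⁻ n q∈))

∈-perms⁺ : ∀ n {p} → p ↭ applyDownFrom suc n → p ∈ perms n
∈-perms⁺ zero p↭[] rewrite ↭-empty-inv p↭[] = here refl
∈-perms⁺ (suc n) p↭ with ∈-∃++ (∈-resp-↭ (↭-sym p↭) (here refl))
... | a , b , refl = ∈-concat⁺′ (insertEverywhere-∈⁺ a b) (∈-map⁺ _ (∈-perms⁺ n (drop-mid a [] p↭)))

perms-unique : ∀ n → Unique (perms n)
perms-unique zero = [] ∷ []
perms-unique (suc n) = concatMap-insertEverywhere-unique (perms-unique n) (All.tabulate new∉)
  where
  new∉ : ∀ {q} → q ∈ perms n → suc n ∉ q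
  new∉ q∈ = Unique.Unique[x∷xs]⇒x∉xs (applyDownFrom-suc-unique (suc n)) ∘ ∈-resp-↭ (∈-perms⁻ n q∈)

∈-perms-unique : ∀ n {p} → p ∈ perms n → Unique p
∈-perms-unique n p∈ = Unique-resp-↭ (↭⇒↭ₛ (↭-sym (∈-perms⁻ n p∈))) (applyDownFrom-suc-unique n)

-- Counting along an involution

length-filter-map : ∀ {A : Set} {P Q : A → Set} (P? : Decidable P) (Q? : Decidable Q) {g : A → A} {ys} →
                    (∀ {x} → x ∈ ys → P (g x) ⇔ Q x) →
                    length (filter P? (map g ys)) ≡ length (filter Q? ys)
length-filter-map P? Q? {ys = []} _ = refl
length-filter-map P? Q? {g} {y ∷ ys} P∘g⇔Q
  with does (P? (g y)) | does (Q? y) | does-⇔ (P∘g⇔Q (here refl)) (P? (g y)) (Q? y)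
... | true  | true  | _ = cong suc (length-filter-map P? Q? (P∘g⇔Q ∘ there))
... | false | false | _ = length-filter-map P? Q? (P∘g⇔Q ∘ there)

module _ {A : Set} {g : A → A} {xs : List A} (xs! : Unique xs)
         (g∈ : ∀ {x} → x ∈ xs → g x ∈ xs) (gg≡ : ∀ {x} → x ∈ xs → g (g x) ≡ x) where

  ↭-map-involution : xs ↭ map g xs
  ↭-map-involution = ∼bag⇒↭ (unique∧set⇒bag xs! gxs! (mk⇔ to from))
    where
    ggxs≡xs : map g (map g xs) ≡ xs
    ggxs≡xs = trans (sym (map-∘ xs)) (map-id-local (All.tabulate gg≡))
    gxs! : Unique (map g xs)
    gxs! = Unique.map⁻ {f = g} (subst Unique (sym ggxs≡xs) xs!)
    to : ∀ {x} → x ∈ xs → x ∈ map g xs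
    to x∈ = subst (_∈ map g xs) (gg≡ x∈) (∈-map⁺ g (g∈ x∈))
    from : ∀ {x} → x ∈ map g xs → x ∈ xs
    from x∈ with ∈-map⁻ g x∈
    ... | _ , y∈ , refl = g∈ y∈

  length-filter-involution : ∀ {P Q : A → Set} (P? : Decidable P) (Q? : Decidable Q) →
                             (∀ {x} → x ∈ xs → P (g x) ⇔ Q x) →
                             length (filter P? xs) ≡ length (filter Q? xs)
  length-filter-involution P? Q? P∘g⇔Q =
    trans (↭-length (filter-↭ P? ↭-map-involution)) (length-filter-map P? Q? P∘g⇔Q)

mainTheorem4 : (n : ℕ) → (k : ℕ) →
    length (filter (λ p → twoStackSortable? p ×-dec (des p ≟ k)) (perms (suc n)))
      ≡ length (filter (λ p → twoStackSortable? p ×-dec (asc p ≟ k)) (perms (suc n)))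
mainTheorem4 n k =
  length-filter-involution (perms-unique (suc n)) φ-∈ (φ-involutive ∘ p!) _ _
    (λ p∈ → twoStackSortable-φ (p! p∈) ×-⇔ des-φ≡k⇔ (p! p∈))
  where
  p! : ∀ {p} → p ∈ perms (suc n) → Unique p
  p! = ∈-perms-unique (suc n)
  φ-∈ : ∀ {p} → p ∈ perms (suc n) → φ p ∈ perms (suc n)
  φ-∈ {p} p∈ = ∈-perms⁺ (suc n) (↭-trans (φ-↭ p) (∈-perms⁻ (suc n) p∈))
  des-φ≡k⇔ : ∀ {p} → Unique p → (des (φ p) ≡ k) ⇔ (asc p ≡ k)
  des-φ≡k⇔ p! = mk⇔ (trans (sym (des-φ p!))) (trans (des-φ p!))
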